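{- Let $P$ be a Laurent polynomial in $x_1,\ldots,x_r$ with integer coefficients, $p$ a prime, $m\geq\deg(P)-1$ an integer, and $T=[-m,m]^r\cap\mathbb{Z}^r$. For every $k\in\{0,1,\ldots,p-1\}$ and every $i\in T$, $$\Lambda_p(P^k\mathbf{x}^i)=\sum_{j\in T}a^k_{i-pj}\,\mathbf{x}^j.$$
   Context: $\mathbf{x}^i=x_1^{i_1}\cdots x_r^{i_r}$ for $i\in\mathbb{Z}^r$. $\deg R$ is the largest absolute value of any exponent of any single variable in $R$. For $n\in\mathbb{N}$ and $k\in\mathbb{Z}^r$, $a^n_k$ denotes the coefficient of $\mathbf{x}^{ -k}$ in $P^n$ (so $a^n_k=\mathrm{ct}(P^n\mathbf{x}^k)$, with $\mathrm{ct}$ the constant term). $\Lambda_p\left(\sum_i q_i\mathbf{x}^i\right)=\sum_{i:\,p\mid i}q_i\mathbf{x}^{i/p}$, where $p\mid i$ means $p$ divides every coordinate of $i$. -}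

module Defs where

open import Data.Nat as ℕ using (ℕ; zero; suc)
open import Data.Nat.DivMod as ℕD using ()
open import Data.Integer as ℤ using (ℤ; +_; ∣_∣)
open import Data.Integer.DivMod using (_/_)
open import Data.Integer.Properties using () renaming (_≟_ to _≟ℤ_)
open import Data.Vec as V using (Vec; []; _∷_)
open import Data.Vec.Properties using (≡-dec)
open import Data.Vec.Relation.Unary.All as VAll using ()
open import Data.List as L using (List; []; _∷_; concatMap; upTo)
open import Data.Product using (_×_; _,_)
open import Data.Bool using (Bool; true; false; _∧_)
open import Relation.Nullary using (yes; no; ¬_; does)
open import Relation.Binary.PropositionalEquality using (_≡_)

-- Exponent vectors i ∈ ℤ^r (the monomial x^i = x_1^{i_1} ⋯ x_r^{i_r}).
Mono : ℕ → Set
Mono r = Vec ℤ r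

-- A Laurent polynomial in r variables with integer coefficients, given as a
-- finite formal sum of terms  c · x^e  (list of (c , e)). Repeated exponents
-- are allowed; the coefficient of x^e is the sum of the matching c's.
LPoly : ℕ → Set
LPoly r = List (ℤ × Mono r)

coeff : ∀ {r} → LPoly r → Mono r → ℤ
coeff [] e = + 0
coeff ((c , f) ∷ P) e with ≡-dec _≟ℤ_ f e
... | yes _ = c ℤ.+ coeff P e
... | no  _ = coeff P e

infix 4 _≈_
_≈_ : ∀ {r} → LPoly r → LPoly r → Set
P ≈ Q = ∀ e → coeff P e ≡ coeff Q e

monomial : ∀ {r} → Mono r → LPoly r
monomial i = (+ 1 , i) ∷ []

one : ∀ {r} → LPoly r
one = monomial (V.replicate _ (+ 0))

mul : ∀ {r} → LPoly r → LPoly r → LPoly r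
mul P Q = concatMap (λ { (c , e) → L.map (λ { (d , f) → (c ℤ.* d , V.zipWith ℤ._+_ e f) }) Q }) P

pow : ∀ {r} → LPoly r → ℕ → LPoly r
pow P zero = one
pow P (suc n) = mul P (pow P n)

a : ∀ {r} → LPoly r → ℕ → Mono r → ℤ
a P n k = coeff (pow P n) (V.map ℤ.-_ k)

-- degree bound: every exponent of every variable occurring (with nonzero
-- coefficient) in P has absolute value ≤ d;  i.e.  deg P ≤ d.
DegAtMost : ∀ {r} → LPoly r → ℕ → Set
DegAtMost {r} P d = ∀ (e : Mono r) → ¬ (coeff P e ≡ + 0) → VAll.All (λ z → ∣ z ∣ ℕ.≤ d) e

divisible : ℕ → ℤ → Bool
divisible zero z = false
divisible (suc n) z = does (∣ z ∣ ℕ.≟ (∣ z ∣ ℕ./ suc n) ℕ.* suc n)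

allDiv : ∀ {r} → ℕ → Mono r → Bool
allDiv p [] = true
allDiv p (z ∷ e) = divisible p z ∧ allDiv p e

divVec : ∀ {r} → ℕ → Mono r → Mono r
divVec zero e = e
divVec (suc n) e = V.map (λ z → z / + suc n) e

Λ : ∀ {r} → ℕ → LPoly r → LPoly r
Λ p [] = []
Λ p ((c , e) ∷ Q) with allDiv p e
... | true  = (c , divVec p e) ∷ Λ p Q
... | false = Λ p Q

InBox : ∀ {r} → ℕ → Mono r → Set
InBox m i = VAll.All (λ z → ∣ z ∣ ℕ.≤ m) i

range : ℕ → List ℤ
range m = L.map (λ k → + k ℤ.- + m) (upTo (suc (2 ℕ.* m)))

box : (r m : ℕ) → List (Mono r)
box zero m = [] ∷ []
box (suc r) m = concatMap (λ x → L.map (x ∷_) (box r m)) (range m)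

rhs : ∀ {r} → LPoly r → ℕ → ℕ → ℕ → Mono r → LPoly r
rhs {r} P p m k i =
  L.map (λ j → (a P k (V.zipWith ℤ._-_ i (V.map (λ z → + p ℤ.* z) j)) , j)) (box r m)

-- Reading off coefficients, Λ_p(Q) has coefficient Q_{pe} at x^e, and the
-- coefficient of P^k x^i at x^{pe} is (P^k)_{pe−i} = a^k_{i−pe}; the
-- right-hand side lists every e ∈ T exactly once, so the two sides agree on T.
-- Off T some |e_t| ≥ m + 1, whence |pe_t − i_t| ≥ p(m + 1) − m > k(m + 1) as
-- k < p; but deg P ≤ m + 1 confines the support of P^k to [−k(m+1), k(m+1)]^r,
-- so the left-hand coefficient vanishes as well. Primality only gives p ≠ 0.
module Submission where

open import Defs
open import Data.Nat as ℕ using (ℕ; zero; suc; _<_; z≤n; s≤s)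
import Data.Nat.Properties as ℕP
open import Data.Nat.Divisibility using (_∣_; divides; n∣m⇒m%n≡0; m∣m*n)
import Data.Nat.DivMod as ℕD
open import Data.Nat.Primality using (Prime; prime⇒nonZero)
open import Data.Integer as ℤ using (ℤ; +_; -[1+_]; ∣_∣)
import Data.Integer.Properties as ℤP
open import Data.Integer.DivMod using (_/_; a≡a%n+[a/n]*n)
open import Data.Integer.Tactic.RingSolver using (solve-∀)
open import Data.Vec as V using ([]; _∷_)
open import Data.Vec.Properties using (≡-dec; zipWith-comm; ∷-injectiveˡ; ∷-injectiveʳ)
open import Data.Vec.Relation.Unary.All as VAll using ([]; _∷_)
open import Data.List as L using (List; []; _∷_; _++_; upTo)
open import Data.List.Properties using (upTo-∷ʳ)
open import Data.Product using (_,_)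
open import Data.Sum using (inj₁; inj₂)
open import Data.Bool using (true; false)
open import Data.Bool.Properties using (T-≡)
open import Function.Bundles using (Equivalence)
open import Data.Empty using (⊥-elim)
open import Function.Definitions using (Injective)
open import Relation.Nullary using (Dec; yes; no; ¬_)
open import Relation.Nullary.Decidable using (dec-true)
open import Relation.Binary.Definitions using (DecidableEquality)
open import Relation.Binary.PropositionalEquality

infix 4 _≟ᵛ_

_≟ᵛ_ : ∀ {r} → DecidableEquality (Mono r)
_≟ᵛ_ = ≡-dec ℤP._≟_

coeff-head-≡ : ∀ {r} (c : ℤ) (f e : Mono r) (Q : LPoly r) → f ≡ e → coeff ((c , f) ∷ Q) e ≡ c ℤ.+ coeff Q e
coeff-head-≡ c f e Q f≡e with f ≟ᵛ e
... | yes _   = refl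
... | no  f≢e = ⊥-elim (f≢e f≡e)

coeff-head-≢ : ∀ {r} (c : ℤ) (f e : Mono r) (Q : LPoly r) → ¬ f ≡ e → coeff ((c , f) ∷ Q) e ≡ coeff Q e
coeff-head-≢ c f e Q f≢e with f ≟ᵛ e
... | yes f≡e = ⊥-elim (f≢e f≡e)
... | no  _   = refl

coeff-++ : ∀ {r} (A B : LPoly r) e → coeff (A ++ B) e ≡ coeff A e ℤ.+ coeff B e
coeff-++ [] B e = sym (ℤP.+-identityˡ _)
coeff-++ ((c , f) ∷ A) B e with f ≟ᵛ e
... | yes _ = trans (cong (λ t → c ℤ.+ t) (coeff-++ A B e)) (sym (ℤP.+-assoc c _ _))
... | no  _ = coeff-++ A B e

i-j+j≡i : ∀ i j → i ℤ.- j ℤ.+ j ≡ i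
i-j+j≡i = solve-∀

i+j-j≡i : ∀ i j → i ℤ.+ j ℤ.- j ≡ i
i+j-j≡i = solve-∀

infixl 6 _+ᵛ_ _-ᵛ_

_+ᵛ_ : ∀ {r} → Mono r → Mono r → Mono r
_+ᵛ_ = V.zipWith ℤ._+_

_-ᵛ_ : ∀ {r} → Mono r → Mono r → Mono r
_-ᵛ_ = V.zipWith ℤ._-_

+ᵛ-comm : ∀ {r} (f g : Mono r) → f +ᵛ g ≡ g +ᵛ f
+ᵛ-comm = zipWith-comm ℤP.+-comm

+ᵛ-ᵛ-cancel : ∀ {r} (f g : Mono r) → f +ᵛ g -ᵛ g ≡ f
+ᵛ-ᵛ-cancel [] [] = refl
+ᵛ-ᵛ-cancel (x ∷ f) (y ∷ g) = cong₂ _∷_ (i+j-j≡i x y) (+ᵛ-ᵛ-cancel f g)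

-ᵛ+ᵛ-cancel : ∀ {r} (f g : Mono r) → f -ᵛ g +ᵛ g ≡ f
-ᵛ+ᵛ-cancel [] [] = refl
-ᵛ+ᵛ-cancel (x ∷ f) (y ∷ g) = cong₂ _∷_ (i-j+j≡i x y) (-ᵛ+ᵛ-cancel f g)

+ᵛ≡⇒≡-ᵛ : ∀ {r} {f g e : Mono r} → f +ᵛ g ≡ e → f ≡ e -ᵛ g
+ᵛ≡⇒≡-ᵛ {f = f} {g} refl = sym (+ᵛ-ᵛ-cancel f g)

≡-ᵛ⇒+ᵛ≡ : ∀ {r} {f g e : Mono r} → f ≡ e -ᵛ g → f +ᵛ g ≡ e
≡-ᵛ⇒+ᵛ≡ {g = g} {e} refl = -ᵛ+ᵛ-cancel e g

map-neg--ᵛ : ∀ {r} (i j : Mono r) → V.map ℤ.-_ (i -ᵛ j) ≡ j -ᵛ i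
map-neg--ᵛ [] [] = refl
map-neg--ᵛ (x ∷ i) (y ∷ j) = cong₂ _∷_ (-[i-j]≡j-i x y) (map-neg--ᵛ i j)
  where
  -[i-j]≡j-i : ∀ i j → ℤ.- (i ℤ.- j) ≡ j ℤ.- i
  -[i-j]≡j-i = solve-∀

coeff-mul-monomial : ∀ {r} (A : LPoly r) (i e : Mono r) → coeff (mul A (monomial i)) e ≡ coeff A (e -ᵛ i)
coeff-mul-monomial [] i e = refl
coeff-mul-monomial ((c , f) ∷ A) i e with f +ᵛ i ≟ᵛ e
... | yes f+i≡e = begin
  c ℤ.* + 1 ℤ.+ coeff (mul A (monomial i)) e ≡⟨ cong₂ ℤ._+_ (ℤP.*-identityʳ c) (coeff-mul-monomial A i e) ⟩
  c ℤ.+ coeff A (e -ᵛ i)                     ≡⟨ coeff-head-≡ c f (e -ᵛ i) A (+ᵛ≡⇒≡-ᵛ f+i≡e) ⟨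
  coeff ((c , f) ∷ A) (e -ᵛ i)               ∎
  where open ≡-Reasoning
... | no f+i≢e = trans (coeff-mul-monomial A i e)
                   (sym (coeff-head-≢ c f (e -ᵛ i) A (λ f≡e-i → f+i≢e (≡-ᵛ⇒+ᵛ≡ f≡e-i))))

weightedSum : ∀ {r} → LPoly r → (Mono r → ℤ) → ℤ
weightedSum [] h = + 0
weightedSum ((c , f) ∷ A) h = c ℤ.* h f ℤ.+ weightedSum A h

coeff-scale-shift : ∀ {r} (c : ℤ) (f : Mono r) (B : LPoly r) e →
  coeff (L.map (λ { (d , g) → (c ℤ.* d , f +ᵛ g) }) B) e ≡ c ℤ.* coeff B (e -ᵛ f)
coeff-scale-shift c f [] e = sym (ℤP.*-zeroʳ c)
coeff-scale-shift c f ((d , g) ∷ B) e with f +ᵛ g ≟ᵛ e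
... | yes f+g≡e = begin
  c ℤ.* d ℤ.+ _                 ≡⟨ cong (λ t → c ℤ.* d ℤ.+ t) (coeff-scale-shift c f B e) ⟩
  c ℤ.* d ℤ.+ c ℤ.* coeff B _   ≡⟨ ℤP.*-distribˡ-+ c d _ ⟨
  c ℤ.* (d ℤ.+ coeff B _)       ≡⟨ cong (c ℤ.*_) (coeff-head-≡ d g _ B (+ᵛ≡⇒≡-ᵛ (trans (+ᵛ-comm g f) f+g≡e))) ⟨
  c ℤ.* coeff ((d , g) ∷ B) _   ∎
  where open ≡-Reasoning
... | no f+g≢e = trans (coeff-scale-shift c f B e)
  (cong (c ℤ.*_) (sym (coeff-head-≢ d g _ B (λ g≡e-f → f+g≢e (trans (+ᵛ-comm f g) (≡-ᵛ⇒+ᵛ≡ g≡e-f))))))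

coeff-mul : ∀ {r} (A B : LPoly r) e → coeff (mul A B) e ≡ weightedSum A (λ f → coeff B (e -ᵛ f))
coeff-mul [] B e = refl
coeff-mul ((c , f) ∷ A) B e =
  trans (coeff-++ (L.map (λ { (d , g) → (c ℤ.* d , f +ᵛ g) }) B) (mul A B) e)
        (cong₂ ℤ._+_ (coeff-scale-shift c f B e) (coeff-mul A B e))

removeExponent : ∀ {r} → Mono r → LPoly r → LPoly r
removeExponent f [] = []
removeExponent f ((c , g) ∷ A) with g ≟ᵛ f
... | yes _ = removeExponent f A
... | no  _ = (c , g) ∷ removeExponent f A

length-removeExponent : ∀ {r} (f : Mono r) A → L.length (removeExponent f A) ℕ.≤ L.length A
length-removeExponent f [] = z≤n
length-removeExponent f ((c , g) ∷ A) with g ≟ᵛ f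
... | yes _ = ℕP.m≤n⇒m≤1+n (length-removeExponent f A)
... | no  _ = s≤s (length-removeExponent f A)

length-removeExponent-head : ∀ {r} (c : ℤ) (f : Mono r) A →
  L.length (removeExponent f ((c , f) ∷ A)) ℕ.≤ L.length A
length-removeExponent-head c f A with f ≟ᵛ f
... | yes _   = length-removeExponent f A
... | no  f≢f = ⊥-elim (f≢f refl)

coeff-removeExponent-≡ : ∀ {r} (f : Mono r) A → coeff (removeExponent f A) f ≡ + 0
coeff-removeExponent-≡ f [] = refl
coeff-removeExponent-≡ f ((c , g) ∷ A) with g ≟ᵛ f
... | yes _   = coeff-removeExponent-≡ f A
... | no  g≢f = trans (coeff-head-≢ c g f _ g≢f) (coeff-removeExponent-≡ f A)

coeff-removeExponent-≢ : ∀ {r} (f e : Mono r) A → ¬ f ≡ e → coeff (removeExponent f A) e ≡ coeff A e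
coeff-removeExponent-≢ f e [] _ = refl
coeff-removeExponent-≢ f e ((c , g) ∷ A) f≢e with g ≟ᵛ f
... | yes g≡f = trans (coeff-removeExponent-≢ f e A f≢e)
                      (sym (coeff-head-≢ c g e A (λ g≡e → f≢e (trans (sym g≡f) g≡e))))
... | no  _ with g ≟ᵛ e
...   | yes _ = cong (λ t → c ℤ.+ t) (coeff-removeExponent-≢ f e A f≢e)
...   | no  _ = coeff-removeExponent-≢ f e A f≢e

weightedSum-split : ∀ {r} (f : Mono r) A h →
  weightedSum A h ≡ coeff A f ℤ.* h f ℤ.+ weightedSum (removeExponent f A) h
weightedSum-split f [] h = refl
weightedSum-split f ((c , g) ∷ A) h with g ≟ᵛ f
... | yes refl = begin
  c ℤ.* h g ℤ.+ weightedSum A h                                  ≡⟨ cong (λ t → c ℤ.* h g ℤ.+ t) (weightedSum-split g A h) ⟩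
  c ℤ.* h g ℤ.+ (coeff A g ℤ.* h g ℤ.+ weightedSum A′ h)         ≡⟨ ℤP.+-assoc (c ℤ.* h g) _ _ ⟨
  c ℤ.* h g ℤ.+ coeff A g ℤ.* h g ℤ.+ weightedSum A′ h           ≡⟨ cong (λ t → t ℤ.+ weightedSum A′ h) (ℤP.*-distribʳ-+ (h g) c _) ⟨
  (c ℤ.+ coeff A g) ℤ.* h g ℤ.+ weightedSum A′ h                 ∎
  where
  open ≡-Reasoning
  A′ : LPoly _
  A′ = removeExponent g A
... | no _ = begin
  c ℤ.* h g ℤ.+ weightedSum A h                                  ≡⟨ cong (λ t → c ℤ.* h g ℤ.+ t) (weightedSum-split f A h) ⟩
  c ℤ.* h g ℤ.+ (coeff A f ℤ.* h f ℤ.+ weightedSum A′ h)         ≡⟨ x+[y+z]≡y+[x+z] (c ℤ.* h g) (coeff A f ℤ.* h f) (weightedSum A′ h) ⟩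
  coeff A f ℤ.* h f ℤ.+ (c ℤ.* h g ℤ.+ weightedSum A′ h)         ∎
  where
  open ≡-Reasoning
  A′ : LPoly _
  A′ = removeExponent f A
  x+[y+z]≡y+[x+z] : ∀ x y z → x ℤ.+ (y ℤ.+ z) ≡ y ℤ.+ (x ℤ.+ z)
  x+[y+z]≡y+[x+z] = solve-∀

-- Terms of A may cancel, so they are collected by exponent before h is used;
-- removeExponent does not return a sublist tail, hence the length bound.
weightedSum-vanishes-≤ : ∀ {r} (n : ℕ) (A : LPoly r) (h : Mono r → ℤ) → L.length A ℕ.≤ n →
  (∀ g → ¬ coeff A g ≡ + 0 → h g ≡ + 0) → weightedSum A h ≡ + 0
weightedSum-vanishes-≤ n [] h _ _ = refl
weightedSum-vanishes-≤ (suc n) A@((c , f) ∷ A₀) h (s≤s |A₀|≤n) h-on-support =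
  trans (weightedSum-split f A h) (cong₂ ℤ._+_ term-f-vanishes rest-vanishes)
  where
  term-f-vanishes : coeff A f ℤ.* h f ≡ + 0
  term-f-vanishes with coeff A f ℤP.≟ + 0
  ... | yes cf≡0 = cong (ℤ._* h f) cf≡0
  ... | no  cf≢0 = trans (cong (coeff A f ℤ.*_) (h-on-support f cf≢0)) (ℤP.*-zeroʳ (coeff A f))
  h-on-support′ : ∀ g → ¬ coeff (removeExponent f A) g ≡ + 0 → h g ≡ + 0
  h-on-support′ g cg≢0 with f ≟ᵛ g
  ... | yes refl = ⊥-elim (cg≢0 (coeff-removeExponent-≡ f A))
  ... | no  f≢g  = h-on-support g (λ cg≡0 → cg≢0 (trans (coeff-removeExponent-≢ f g A f≢g) cg≡0))
  rest-vanishes : weightedSum (removeExponent f A) h ≡ + 0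
  rest-vanishes = weightedSum-vanishes-≤ n (removeExponent f A) h
    (ℕP.≤-trans (length-removeExponent-head c f A₀) |A₀|≤n) h-on-support′

weightedSum-vanishes : ∀ {r} (A : LPoly r) (h : Mono r → ℤ) →
  (∀ g → ¬ coeff A g ≡ + 0 → h g ≡ + 0) → weightedSum A h ≡ + 0
weightedSum-vanishes A h = weightedSum-vanishes-≤ (L.length A) A h ℕP.≤-refl

InBox-+ : ∀ {r} {a b : ℕ} {f g : Mono r} → InBox a f → InBox b (g -ᵛ f) → InBox (a ℕ.+ b) g
InBox-+ {f = []} {[]} [] [] = []
InBox-+ {a = a} {b} {x ∷ f} {y ∷ g} (∣x∣≤a ∷ f∈a) (∣y-x∣≤b ∷ g-f∈b) = ∣y∣≤a+b ∷ InBox-+ f∈a g-f∈b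
  where
  open ℕP.≤-Reasoning
  ∣y∣≤a+b : ∣ y ∣ ℕ.≤ a ℕ.+ b
  ∣y∣≤a+b = begin
    ∣ y ∣                     ≡⟨ cong ∣_∣ (trans (sym (i-j+j≡i y x)) (ℤP.+-comm (y ℤ.- x) x)) ⟩
    ∣ x ℤ.+ (y ℤ.- x) ∣       ≤⟨ ℤP.∣i+j∣≤∣i∣+∣j∣ x (y ℤ.- x) ⟩
    ∣ x ∣ ℕ.+ ∣ y ℤ.- x ∣     ≤⟨ ℕP.+-mono-≤ ∣x∣≤a ∣y-x∣≤b ⟩
    a ℕ.+ b                   ∎

InBox-0-zero : ∀ r → InBox 0 (V.replicate r (+ 0))
InBox-0-zero zero    = []
InBox-0-zero (suc r) = z≤n ∷ InBox-0-zero r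

coeff-pow-outside : ∀ {r} (P : LPoly r) (d : ℕ) → DegAtMost P d →
  ∀ k g → ¬ InBox (k ℕ.* d) g → coeff (pow P k) g ≡ + 0
coeff-pow-outside {r} P d deg zero g g∉box =
  coeff-head-≢ (+ 1) _ g [] (λ 0≡g → g∉box (subst (InBox 0) 0≡g (InBox-0-zero r)))
coeff-pow-outside P d deg (suc k) g g∉box =
  trans (coeff-mul P (pow P k) g) (weightedSum-vanishes P _ vanishes-on-support)
  where
  vanishes-on-support : ∀ f → ¬ coeff P f ≡ + 0 → coeff (pow P k) (g -ᵛ f) ≡ + 0
  vanishes-on-support f cf≢0 =
    coeff-pow-outside P d deg k (g -ᵛ f) (λ g-f∈box → g∉box (InBox-+ (deg f cf≢0) g-f∈box))

scale : ∀ {r} → ℕ → Mono r → Mono r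
scale p = V.map (λ z → + p ℤ.* z)

∣z∣%n≡0⇒z%ℕn≡0 : ∀ n z → ∣ z ∣ ℕ.% suc n ≡ 0 → z ℤ.%ℕ suc n ≡ 0
∣z∣%n≡0⇒z%ℕn≡0 n (+ x) eq = eq
∣z∣%n≡0⇒z%ℕn≡0 n -[1+ x ] eq with suc x ℕ.% suc n | eq
... | zero | _ = refl

divisible⇒≡*quotient : ∀ n z → divisible (suc n) z ≡ true → z ≡ + suc n ℤ.* (z / + suc n)
divisible⇒≡*quotient n z divisible-z = begin
  z                                       ≡⟨ a≡a%n+[a/n]*n z (+ suc n) ⟩
  + (z ℤ.%ℕ suc n) ℤ.+ z / + suc n ℤ.* + suc n
      ≡⟨ cong (λ t → + t ℤ.+ z / + suc n ℤ.* + suc n) (∣z∣%n≡0⇒z%ℕn≡0 n z (n∣m⇒m%n≡0 ∣ z ∣ (suc n) (divides (∣ z ∣ ℕ./ suc n) ∣z∣≡q*p))) ⟩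
  + 0 ℤ.+ z / + suc n ℤ.* + suc n         ≡⟨ ℤP.+-identityˡ _ ⟩
  z / + suc n ℤ.* + suc n                 ≡⟨ ℤP.*-comm (z / + suc n) (+ suc n) ⟩
  + suc n ℤ.* (z / + suc n)               ∎
  where
  open ≡-Reasoning
  ∣z∣≡q*p : ∣ z ∣ ≡ (∣ z ∣ ℕ./ suc n) ℕ.* suc n
  ∣z∣≡q*p = ℕP.≡ᵇ⇒≡ ∣ z ∣ ((∣ z ∣ ℕ./ suc n) ℕ.* suc n) (Equivalence.from T-≡ divisible-z)

divisible-* : ∀ n w → divisible (suc n) (+ suc n ℤ.* w) ≡ true
divisible-* n w = dec-true (∣ z ∣ ℕ.≟ (∣ z ∣ ℕ./ suc n) ℕ.* suc n) (sym (ℕD.m/n*n≡m p∣∣z∣))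
  where
  z : ℤ
  z = + suc n ℤ.* w
  p∣∣z∣ : suc n ∣ ∣ z ∣
  p∣∣z∣ = subst (suc n ∣_) (sym (ℤP.abs-* (+ suc n) w)) (m∣m*n ∣ w ∣)

*-/-cancel : ∀ n w → (+ suc n ℤ.* w) / + suc n ≡ w
*-/-cancel n w = sym (ℤP.*-cancelˡ-≡ (+ suc n) w _ (divisible⇒≡*quotient n (+ suc n ℤ.* w) (divisible-* n w)))

allDiv⇒≡scale : ∀ {r} n (f : Mono r) → allDiv (suc n) f ≡ true → f ≡ scale (suc n) (divVec (suc n) f)
allDiv⇒≡scale n [] _ = refl
allDiv⇒≡scale n (z ∷ f) all-divisible with divisible (suc n) z in divisible-z
... | true = cong₂ _∷_ (divisible⇒≡*quotient n z divisible-z) (allDiv⇒≡scale n f all-divisible)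

allDiv-scale : ∀ {r} n (e : Mono r) → allDiv (suc n) (scale (suc n) e) ≡ true
allDiv-scale n [] = refl
allDiv-scale n (w ∷ e) rewrite divisible-* n w = allDiv-scale n e

divVec-scale : ∀ {r} n (e : Mono r) → divVec (suc n) (scale (suc n) e) ≡ e
divVec-scale n [] = refl
divVec-scale n (w ∷ e) = cong₂ _∷_ (*-/-cancel n w) (divVec-scale n e)

coeff-Λ : ∀ {r} n (Q : LPoly r) e → coeff (Λ (suc n) Q) e ≡ coeff Q (scale (suc n) e)
coeff-Λ n [] e = refl
coeff-Λ n ((c , f) ∷ Q) e with allDiv (suc n) f in all-divisible
... | true with divVec (suc n) f ≟ᵛ e
...   | yes f/p≡e = trans (cong (λ t → c ℤ.+ t) (coeff-Λ n Q e))
          (sym (coeff-head-≡ c f _ Q (trans (allDiv⇒≡scale n f all-divisible) (cong (scale (suc n)) f/p≡e))))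
...   | no  f/p≢e = trans (coeff-Λ n Q e)
          (sym (coeff-head-≢ c f _ Q (λ f≡pe → f/p≢e (trans (cong (divVec (suc n)) f≡pe) (divVec-scale n e)))))
coeff-Λ n ((c , f) ∷ Q) e | false = trans (coeff-Λ n Q e)
          (sym (coeff-head-≢ c f _ Q (λ f≡pe → true≢false (trans (sym (allDiv-scale n e))
                                                   (trans (cong (allDiv (suc n)) (sym f≡pe)) all-divisible)))))
  where
  true≢false : ¬ true ≡ false
  true≢false ()

occurrences : ∀ {A : Set} → DecidableEquality A → A → List A → ℕ
occurrences _≟_ x [] = 0
occurrences _≟_ x (y ∷ ys) with y ≟ x
... | yes _ = suc (occurrences _≟_ x ys)
... | no  _ = occurrences _≟_ x ys

module _ {A : Set} (_≟_ : DecidableEquality A) where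

  occurrences-++ : ∀ x xs ys → occurrences _≟_ x (xs ++ ys) ≡ occurrences _≟_ x xs ℕ.+ occurrences _≟_ x ys
  occurrences-++ x [] ys = refl
  occurrences-++ x (y ∷ xs) ys with y ≟ x
  ... | yes _ = cong suc (occurrences-++ x xs ys)
  ... | no  _ = occurrences-++ x xs ys

  occurrences-map-injective : ∀ {B : Set} (_≟′_ : DecidableEquality B) {f : B → A} → Injective _≡_ _≡_ f →
    ∀ x xs → occurrences _≟_ (f x) (L.map f xs) ≡ occurrences _≟′_ x xs
  occurrences-map-injective _≟′_ {f} f-inj x [] = refl
  occurrences-map-injective _≟′_ {f} f-inj x (y ∷ xs) with f y ≟ f x | y ≟′ x
  ... | yes _     | yes _   = cong suc (occurrences-map-injective _≟′_ f-inj x xs)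
  ... | no  _     | no  _   = occurrences-map-injective _≟′_ f-inj x xs
  ... | yes fy≡fx | no  y≢x = ⊥-elim (y≢x (f-inj fy≡fx))
  ... | no  fy≢fx | yes y≡x = ⊥-elim (fy≢fx (cong f y≡x))

  occurrences-map-∉ : ∀ {B : Set} {f : B → A} {x} → (∀ y → ¬ f y ≡ x) → ∀ ys → occurrences _≟_ x (L.map f ys) ≡ 0
  occurrences-map-∉ x∉f [] = refl
  occurrences-map-∉ {f = f} {x} x∉f (y ∷ ys) with f y ≟ x
  ... | yes fy≡x = ⊥-elim (x∉f y fy≡x)
  ... | no  _    = occurrences-map-∉ x∉f ys

occurrences-upTo-suc : ∀ t n → occurrences ℕ._≟_ t (upTo (suc n)) ≡ occurrences ℕ._≟_ t (upTo n) ℕ.+ occurrences ℕ._≟_ t (n ∷ [])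
occurrences-upTo-suc t n = trans (cong (occurrences ℕ._≟_ t) (sym (upTo-∷ʳ n))) (occurrences-++ ℕ._≟_ t (upTo n) (n ∷ []))

occurrences-upTo-< : ∀ {t n} → t < n → occurrences ℕ._≟_ t (upTo n) ≡ 1
occurrences-upTo-≥ : ∀ {t n} → n ℕ.≤ t → occurrences ℕ._≟_ t (upTo n) ≡ 0
occurrences-upTo-< {t} {suc n} (s≤s t≤n) = trans (occurrences-upTo-suc t n) (last-or-earlier t≤n)
  where
  last-or-earlier : t ℕ.≤ n → occurrences ℕ._≟_ t (upTo n) ℕ.+ occurrences ℕ._≟_ t (n ∷ []) ≡ 1
  last-or-earlier t≤n with n ℕ.≟ t
  ... | yes refl = cong (ℕ._+ 1) (occurrences-upTo-≥ {t} {t} ℕP.≤-refl)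
  ... | no  n≢t  with ℕP.m≤n⇒m<n∨m≡n t≤n
  ...   | inj₁ t<n = cong (ℕ._+ 0) (occurrences-upTo-< t<n)
  ...   | inj₂ t≡n = ⊥-elim (n≢t (sym t≡n))
occurrences-upTo-≥ {t} {zero} _ = refl
occurrences-upTo-≥ {t} {suc n} n<t = trans (occurrences-upTo-suc t n) none
  where
  none : occurrences ℕ._≟_ t (upTo n) ℕ.+ occurrences ℕ._≟_ t (n ∷ []) ≡ 0
  none with n ℕ.≟ t
  ... | yes refl = ⊥-elim (ℕP.<-irrefl refl n<t)
  ... | no  _    = cong (ℕ._+ 0) (occurrences-upTo-≥ (ℕP.<⇒≤ n<t))

occurrences-range-shift : ∀ m t → occurrences ℤP._≟_ (+ t ℤ.- + m) (range m) ≡ occurrences ℕ._≟_ t (upTo (suc (2 ℕ.* m)))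
occurrences-range-shift m t = occurrences-map-injective ℤP._≟_ ℕ._≟_ shift-injective t (upTo (suc (2 ℕ.* m)))
  where
  shift-injective : Injective _≡_ _≡_ (λ k → + k ℤ.- + m)
  shift-injective {k} {l} k-m≡l-m = ℤP.+-injective (begin
    + k                 ≡⟨ i-j+j≡i (+ k) (+ m) ⟨
    + k ℤ.- + m ℤ.+ + m ≡⟨ cong (ℤ._+ + m) k-m≡l-m ⟩
    + l ℤ.- + m ℤ.+ + m ≡⟨ i-j+j≡i (+ l) (+ m) ⟩
    + l                 ∎)
    where open ≡-Reasoning

occurrences-range-∈ : ∀ m y → ∣ y ∣ ℕ.≤ m → occurrences ℤP._≟_ y (range m) ≡ 1
occurrences-range-∈ m (+ a) a≤m =
  trans (cong (λ y → occurrences ℤP._≟_ y (range m)) (sym (i+j-j≡i (+ a) (+ m))))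
    (trans (occurrences-range-shift m (a ℕ.+ m))
      (occurrences-upTo-< (s≤s (ℕP.+-mono-≤ a≤m (ℕP.m≤m+n m 0)))))
occurrences-range-∈ m -[1+ a ] a<m =
  trans (cong (λ y → occurrences ℤP._≟_ y (range m)) y≡m∸[1+a]-m)
    (trans (occurrences-range-shift m (m ℕ.∸ suc a))
      (occurrences-upTo-< (s≤s (ℕP.≤-trans (ℕP.m∸n≤m m (suc a)) (ℕP.m≤m+n m _)))))
  where
  y≡m∸[1+a]-m : -[1+ a ] ≡ + (m ℕ.∸ suc a) ℤ.- + m
  y≡m∸[1+a]-m = trans (sym (i+j-j≡i -[1+ a ] (+ m))) (cong (ℤ._- + m) (ℤP.⊖-≥ a<m))

occurrences-range-∉ : ∀ m y → ¬ ∣ y ∣ ℕ.≤ m → occurrences ℤP._≟_ y (range m) ≡ 0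
occurrences-range-∉ m (+ a) a≰m =
  trans (cong (λ y → occurrences ℤP._≟_ y (range m)) (sym (i+j-j≡i (+ a) (+ m))))
    (trans (occurrences-range-shift m (a ℕ.+ m))
      (occurrences-upTo-≥ (ℕP.+-mono-≤ (ℕP.≰⇒> a≰m) (ℕP.≤-reflexive (ℕP.+-identityʳ m)))))
occurrences-range-∉ m -[1+ a ] 1+a≰m = occurrences-map-∉ ℤP._≟_ never-hit (upTo _)
  where
  m≤a : m ℕ.≤ a
  m≤a = ℕP.≤-pred (ℕP.≰⇒> 1+a≰m)
  -- + k − + m ≥ − + m, while the target lies strictly below − + m.
  never-hit : ∀ k → ¬ + k ℤ.- + m ≡ -[1+ a ]
  never-hit k k-m≡y with trans (trans (sym (i-j+j≡i (+ k) (+ m))) (cong (ℤ._+ + m) k-m≡y))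
                              (trans (ℤP.⊖-< (s≤s m≤a)) (cong (λ t → ℤ.- (+ t)) (ℕP.+-∸-assoc 1 m≤a)))
  ... | ()

occurrences-concatMap-∷ : ∀ {r} y (e : Mono r) (xs : List ℤ) (B : List (Mono r)) →
  occurrences _≟ᵛ_ (y ∷ e) (L.concatMap (λ x → L.map (x ∷_) B) xs)
    ≡ occurrences ℤP._≟_ y xs ℕ.* occurrences _≟ᵛ_ e B
occurrences-concatMap-∷ y e [] B = refl
occurrences-concatMap-∷ y e (x ∷ xs) B
  rewrite occurrences-++ _≟ᵛ_ (y ∷ e) (L.map (x ∷_) B) (L.concatMap (λ x → L.map (x ∷_) B) xs)
        | occurrences-concatMap-∷ y e xs B
  with x ℤP.≟ y
... | yes refl = cong (ℕ._+ occurrences ℤP._≟_ y xs ℕ.* occurrences _≟ᵛ_ e B) (occurrences-map-injective _≟ᵛ_ _≟ᵛ_ ∷-injectiveʳ e B)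
... | no  x≢y  = cong (ℕ._+ occurrences ℤP._≟_ y xs ℕ.* occurrences _≟ᵛ_ e B) (occurrences-map-∉ _≟ᵛ_ (λ f x∷f≡y∷e → x≢y (∷-injectiveˡ x∷f≡y∷e)) B)

occurrences-box-∈ : ∀ r m (e : Mono r) → InBox m e → occurrences _≟ᵛ_ e (box r m) ≡ 1
occurrences-box-∈ zero    m []      []             = refl
occurrences-box-∈ (suc r) m (y ∷ e) (∣y∣≤m ∷ e∈box) =
  trans (occurrences-concatMap-∷ y e (range m) (box r m))
        (cong₂ ℕ._*_ (occurrences-range-∈ m y ∣y∣≤m) (occurrences-box-∈ r m e e∈box))

occurrences-box-∉ : ∀ r m (e : Mono r) → ¬ InBox m e → occurrences _≟ᵛ_ e (box r m) ≡ 0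
occurrences-box-∉ zero    m []      e∉box = ⊥-elim (e∉box [])
occurrences-box-∉ (suc r) m (y ∷ e) y∷e∉box with ∣ y ∣ ℕP.≤? m
... | yes ∣y∣≤m = trans (occurrences-concatMap-∷ y e (range m) (box r m))
    (cong₂ ℕ._*_ (occurrences-range-∈ m y ∣y∣≤m) (occurrences-box-∉ r m e (λ e∈box → y∷e∉box (∣y∣≤m ∷ e∈box))))
... | no  ∣y∣≰m = trans (occurrences-concatMap-∷ y e (range m) (box r m))
    (cong (ℕ._* _) (occurrences-range-∉ m y ∣y∣≰m))

coeff-tabulate : ∀ {r} (g : Mono r → ℤ) (xs : List (Mono r)) e →
  coeff (L.map (λ j → (g j , j)) xs) e ≡ + occurrences _≟ᵛ_ e xs ℤ.* g e
coeff-tabulate g [] e = sym (ℤP.*-zeroˡ (g e))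
coeff-tabulate g (j ∷ xs) e with j ≟ᵛ e
... | yes refl = trans (cong (λ t → g j ℤ.+ t) (coeff-tabulate g xs j)) (sym (ℤP.suc-* (+ occurrences _≟ᵛ_ j xs) (g j)))
... | no  _    = coeff-tabulate g xs e

-- p |z| ≤ m + k (m + 1) < (k + 1)(m + 1) ≤ p (m + 1).
InBox-scale⁻¹ : ∀ {r} {p k m} → k < p → (e : Mono r) → InBox (m ℕ.+ k ℕ.* suc m) (scale p e) → InBox m e
InBox-scale⁻¹ k<p [] [] = []
InBox-scale⁻¹ {p = p} {k} {m} k<p (z ∷ e) (∣pz∣≤ ∷ pe∈box) = ℕP.≤-pred ∣z∣<1+m ∷ InBox-scale⁻¹ k<p e pe∈box
  where
  open ℕP.≤-Reasoning
  ∣z∣<1+m : ∣ z ∣ < suc m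
  ∣z∣<1+m = ℕP.*-cancelˡ-< p ∣ z ∣ (suc m) (begin-strict
    p ℕ.* ∣ z ∣            ≡⟨ ℤP.abs-* (+ p) z ⟨
    ∣ + p ℤ.* z ∣          <⟨ s≤s ∣pz∣≤ ⟩
    suc k ℕ.* suc m        ≤⟨ ℕP.*-monoˡ-≤ (suc m) k<p ⟩
    p ℕ.* suc m            ∎)

proposition6 : ∀ {r : ℕ} (P : LPoly r) (p : ℕ) → Prime p → (m : ℕ) → DegAtMost P (suc m) →
    ∀ (k : ℕ) → k < p → ∀ (i : Mono r) → InBox m i →
      Λ p (mul (pow P k) (monomial i)) ≈ rhs P p m k i
proposition6 P zero p-prime m deg k k<p i i∈T e = ⊥-elim (ℕ.NonZero.nonZero (prime⇒nonZero p-prime))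
proposition6 {r} P p@(suc n) _ m deg k k<p i i∈T e = begin
  coeff (Λ p (mul (pow P k) (monomial i))) e        ≡⟨ coeff-Λ n (mul (pow P k) (monomial i)) e ⟩
  coeff (mul (pow P k) (monomial i)) (scale p e)    ≡⟨ coeff-mul-monomial (pow P k) i (scale p e) ⟩
  coeff (pow P k) (scale p e -ᵛ i)                  ≡⟨ by-position (VAll.all? (λ z → ∣ z ∣ ℕP.≤? m) e) ⟩
  + occurrences _≟ᵛ_ e (box r m) ℤ.* g e            ≡⟨ coeff-tabulate g (box r m) e ⟨
  coeff (rhs P p m k i) e                           ∎
  where
  open ≡-Reasoning
  g : Mono r → ℤ
  g j = a P k (i -ᵛ scale p j)
  by-position : Dec (InBox m e) → coeff (pow P k) (scale p e -ᵛ i) ≡ + occurrences _≟ᵛ_ e (box r m) ℤ.* g e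
  by-position (yes e∈T) = begin
    coeff (pow P k) (scale p e -ᵛ i)         ≡⟨ cong (coeff (pow P k)) (map-neg--ᵛ i (scale p e)) ⟨
    g e                                      ≡⟨ ℤP.*-identityˡ (g e) ⟨
    + 1 ℤ.* g e                              ≡⟨ cong (λ t → + t ℤ.* g e) (occurrences-box-∈ r m e e∈T) ⟨
    + occurrences _≟ᵛ_ e (box r m) ℤ.* g e   ∎
  by-position (no e∉T) = begin
    coeff (pow P k) (scale p e -ᵛ i)         ≡⟨ coeff-pow-outside P (suc m) deg k _ (λ pe-i∈box →
                                                   e∉T (InBox-scale⁻¹ k<p e (InBox-+ i∈T pe-i∈box))) ⟩
    + 0                                      ≡⟨ ℤP.*-zeroˡ (g e) ⟨
    + 0 ℤ.* g e                              ≡⟨ cong (λ t → + t ℤ.* g e) (occurrences-box-∉ r m e e∉T) ⟨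
    + occurrences _≟ᵛ_ e (box r m) ℤ.* g e   ∎
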